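{- Let $m$ be an integer such that there is a resolvable $(56m+8,8,1)$-BIBD. Let $0\leq t\leq 8m$ be an integer and suppose there exists a nested $(3t+1,4,1)$-BIBD. Then there exists a nested $(v,4,1)$-BIBD for $v = 168m+3t+25$.
   Context: A $(v,k,\lambda)$-BIBD is a pair $(X,\mathcal{A})$ with $X$ a set of $v$ points and $\mathcal{A}$ a collection of $k$-subsets (blocks) such that every pair of distinct points lies in exactly $\lambda$ blocks; a partial one has "at most $\lambda$". A BIBD is resolvable if its blocks can be partitioned into parallel classes, each of which is a partition of the point set. A nested $(v,k,\lambda)$-BIBD is a $(v,k,\lambda)$-BIBD $(X,\mathcal{A})$ together with a map $\phi:\mathcal{A}\to X$ such that $(X,\{A\cup\{\phi(A)\}:A\in\mathcal{A}\})$ is a partial $(v,k+1,\lambda+1)$-BIBD (augmented blocks of size $k+1$). -}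

module Defs where

open import Data.Nat using (ℕ; _≤_; _+_)
open import Data.Fin using (Fin)
open import Data.Fin.Properties using (_≟_)
open import Data.List using (List; length; filter; concat; map; tabulate; lookup; _∷_)
open import Data.List.Relation.Unary.Unique.Propositional using (Unique)
open import Data.List.Relation.Unary.All using (All)
open import Data.Product using (Σ; _×_)
open import Relation.Binary.PropositionalEquality using (_≡_)
open import Relation.Nullary using (¬_)
open import Relation.Nullary.Decidable using (_×-dec_)
import Data.List.Membership.DecPropositional as DecMem

-- A collection of blocks is a list
-- (so repeated blocks are allowed, as in the usual multiset convention).
Block : ℕ → Set
Block v = List (Fin v)

IsKSubset : (v k : ℕ) → Block v → Set
IsKSubset v k B = length B ≡ k × Unique B

pairCount : {v : ℕ} → Fin v → Fin v → List (Block v) → ℕ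
pairCount {v} x y 𝒜 = length (filter (λ B → (x ∈? B) ×-dec (y ∈? B)) 𝒜)
  where open DecMem (_≟_ {n = v}) using (_∈?_)

pointCount : {v : ℕ} → Fin v → List (Block v) → ℕ
pointCount {v} x 𝒜 = length (filter (λ B → x ∈? B) 𝒜)
  where open DecMem (_≟_ {n = v}) using (_∈?_)

IsBIBD : (v k lam : ℕ) → List (Block v) → Set
IsBIBD v k lam 𝒜 =
  All (IsKSubset v k) 𝒜 ×
  (∀ (x y : Fin v) → ¬ (x ≡ y) → pairCount x y 𝒜 ≡ lam)

IsPartialBIBD : (v k lam : ℕ) → List (Block v) → Set
IsPartialBIBD v k lam 𝒜 =
  All (IsKSubset v k) 𝒜 ×
  (∀ (x y : Fin v) → ¬ (x ≡ y) → pairCount x y 𝒜 ≤ lam)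

BIBD : (v k lam : ℕ) → Set
BIBD v k lam = Σ (List (Block v)) (IsBIBD v k lam)

IsParallelClass : (v : ℕ) → List (Block v) → Set
IsParallelClass v P = ∀ (x : Fin v) → pointCount x P ≡ 1

ResolvableBIBD : (v k lam : ℕ) → Set
ResolvableBIBD v k lam =
  Σ (List (List (Block v))) λ classes →
    All (IsParallelClass v) classes × IsBIBD v k lam (concat classes)

augment : {v : ℕ} (𝒜 : List (Block v)) → (Fin (length 𝒜) → Fin v) → List (Block v)
augment 𝒜 φ = tabulate (λ i → φ i ∷ lookup 𝒜 i)

-- nested (v,k,λ)-BIBD: a BIBD with a map φ from blocks to points such that
-- the augmented blocks form a partial (v,k+1,λ+1)-BIBD (in particular each
-- augmented block is a (k+1)-set, so φ(A) ∉ A)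
NestedBIBD : (v k lam : ℕ) → Set
NestedBIBD v k lam =
  Σ (List (Block v)) λ 𝒜 → IsBIBD v k lam 𝒜 ×
    Σ (Fin (length 𝒜) → Fin v) λ φ → IsPartialBIBD v (k + 1) (lam + 1) (augment 𝒜 φ)

-- Write the point set as X × ℤ₃ ∪ Y₀ ∪ … ∪ Y_{t−1} ∪ {∞}, where X carries the resolvable
-- (56m+8, 8, 1)-BIBD, whose r = 8m + 1 parallel classes are numbered 0, …, r − 1, and |Yᵢ| = 3.
-- Inflate every block B of class 0 to a nested (25,4,1)-BIBD on B × ℤ₃ ∪ {∞}, every block of class
-- i + 1 with i < t to a nested 4-GDD of type 3⁹ on B × ℤ₃ ∪ Yᵢ (groups {x} × ℤ₃ and Yᵢ), every later
-- block to a nested 4-GDD of type 3⁸ on B × ℤ₃, and put the given nested (3t+1,4,1)-BIBD on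
-- Y ∪ {∞}.  A pair of points is then split by exactly one ingredient: (x,a),(x′,b) with x ≠ x′ by
-- the block through x and x′; (x,a),(x,b) and (x,a),∞ by the class-0 block through x; (x,a) and
-- a point of Yᵢ by the class-(i+1) block through x (this needs t < r, i.e. t ≤ 8m); pairs in
-- Y ∪ {∞} by the core.  So the union of the inflated designs is a nested BIBD.

module Submission where

open import Defs
open import Data.Bool using (true; false)
open import Data.Empty using (⊥; ⊥-elim)
open import Data.Fin using (Fin; zero; suc; #_; toℕ; fromℕ<; punchIn; quotient; remainder; combine; splitAt; join; _↑ˡ_; _↑ʳ_)
open import Data.Fin.Properties using (_≟_; all?; toℕ<n; toℕ-fromℕ<; fromℕ<-toℕ; toℕ-injective; punchIn-injective; punchInᵢ≢i; remQuot-combine; combine-remQuot; splitAt-↑ˡ; splitAt-↑ʳ; join-splitAt)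
open import Data.List using (List; []; _∷_; _++_; map; concat; concatMap; length; filter; tabulate; lookup; allFin)
open import Data.List.Properties using (length-++; length-map; length-tabulate; filter-++; filter-≐; filter-none; map-∘; map-tabulate; tabulate-lookup; map-concatMap)
open import Data.List.Membership.Propositional using (_∈_)
open import Data.List.Membership.Propositional.Properties using (∈-filter⁺; ∈-filter⁻; ∈-∃++; ∈-++⁻; ∈-++⁺ˡ; ∈-++⁺ʳ; ∈-map⁺; ∈-map⁻)
import Data.List.Membership.DecPropositional as DecMembership
open import Data.List.Relation.Binary.Subset.Propositional using (_⊆_)
open import Data.List.Relation.Unary.Any using (Any; here; there)
open import Data.List.Relation.Unary.All using (All; []; _∷_)
import Data.List.Relation.Unary.All as All
import Data.List.Relation.Unary.All.Properties as All
open import Data.List.Relation.Unary.AllPairs using (_∷_)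
open import Data.List.Relation.Unary.Unique.Propositional using (Unique)
import Data.List.Relation.Unary.Unique.Propositional.Properties as Unique
import Data.List.Relation.Unary.Unique.DecPropositional as UniqueDec
open import Data.Maybe using (Maybe; just; nothing)
open import Data.Maybe.Properties using (just-injective)
open import Data.Nat using (ℕ; zero; suc; _≤_; _<_; _+_; _*_; z≤n; s≤s; _<?_)
open import Data.Nat.ListAction using (sum)
import Data.Nat.Properties as ℕ
open import Data.Nat.Properties using (+-mono-≤; +-suc; *-zeroʳ; *-suc; *-monoʳ-≤; ≤-trans; ≤-reflexive; ≤-pred)
open import Data.Nat.Tactic.RingSolver using (solve-∀)
open import Data.Product using (Σ; ∃; ∃₂; _×_; _,_; proj₁; proj₂; uncurry)
import Data.Product as Product
open import Data.Sum using (inj₁; inj₂)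
open import Data.Unit using (⊤; tt)
open import Function using (_∘_; _∘₂_; id; _↔_; Inverse; mk↔ₛ′)
open import Function.Definitions using (Injective)
open import Level using (Level; 0ℓ)
open import Relation.Binary.PropositionalEquality using (_≡_; _≢_; refl; sym; trans; cong; cong₂; subst; subst₂)
open import Relation.Nullary using (¬_; Dec; yes; no; does; ¬?)
open import Relation.Nullary.Decidable using (_×-dec_; _→-dec_; map′; from-yes)
open import Relation.Unary using (Pred; Decidable; ∁; _≐_)

private variable
  ℓ : Level
  A B : Set

-- Counting in lists

count : {P : Pred A ℓ} → Decidable P → List A → ℕ
count P? = length ∘ filter P?

count-++ : {P : Pred A ℓ} (P? : Decidable P) (xs ys : List A) → count P? (xs ++ ys) ≡ count P? xs + count P? ys
count-++ P? xs ys = trans (cong length (filter-++ P? xs ys)) (length-++ (filter P? xs))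

count-concatMap : {P : Pred B ℓ} (P? : Decidable P) (f : A → List B) (xs : List A) →
  count P? (concatMap f xs) ≡ sum (map (count P? ∘ f) xs)
count-concatMap P? f [] = refl
count-concatMap P? f (x ∷ xs) =
  trans (count-++ P? (f x) (concatMap f xs)) (cong (count P? (f x) +_) (count-concatMap P? f xs))

count-map : {P : Pred B ℓ} (P? : Decidable P) (f : A → B) (xs : List A) → count P? (map f xs) ≡ count (P? ∘ f) xs
count-map P? f [] = refl
count-map P? f (x ∷ xs) with does (P? (f x))
... | true = cong suc (count-map P? f xs)
... | false = count-map P? f xs

count-≐ : {P Q : Pred A ℓ} (P? : Decidable P) (Q? : Decidable Q) → P ≐ Q → (xs : List A) → count P? xs ≡ count Q? xs
count-≐ P? Q? P≐Q xs = cong length (filter-≐ P? Q? P≐Q xs)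

count-none : {P : Pred A ℓ} (P? : Decidable P) {xs : List A} → All (∁ P) xs → count P? xs ≡ 0
count-none P? none = cong length (filter-none P? none)

count≡0⇒∉ : {P : Pred A ℓ} (P? : Decidable P) {xs : List A} {x : A} → count P? xs ≡ 0 → x ∈ xs → ¬ P x
count≡0⇒∉ P? {xs} c≡0 x∈xs px with filter P? xs | ∈-filter⁺ P? x∈xs px
... | _ ∷ _ | _ = ℕ.0≢1+n (sym c≡0)

sum-selected : ∀ {P : Pred A ℓ} (S? : Decidable P) (f : A → ℕ) c (xs : List A) →
  (∀ {x} → x ∈ xs → P x → f x ≡ c) → (∀ {x} → x ∈ xs → ¬ P x → f x ≡ 0) →
  sum (map f xs) ≡ c * count S? xs
sum-selected S? f c [] _ _ = sym (*-zeroʳ c)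
sum-selected S? f c (x ∷ xs) on off with S? x
... | yes px = trans (cong₂ _+_ (on (here refl) px) (sum-selected S? f c xs (on ∘ there) (off ∘ there)))
                     (sym (*-suc c _))
... | no ¬px = trans (cong (_+ sum (map f xs)) (off (here refl) ¬px))
                     (sum-selected S? f c xs (on ∘ there) (off ∘ there))

sum-selected-≤ : ∀ {P : Pred A ℓ} (S? : Decidable P) (f : A → ℕ) c (xs : List A) →
  (∀ {x} → x ∈ xs → P x → f x ≤ c) → (∀ {x} → x ∈ xs → ¬ P x → f x ≡ 0) →
  sum (map f xs) ≤ c * count S? xs
sum-selected-≤ S? f c [] _ _ = ≤-reflexive (sym (*-zeroʳ c))
sum-selected-≤ S? f c (x ∷ xs) on off with S? x
... | yes px = ≤-trans (+-mono-≤ (on (here refl) px) (sum-selected-≤ S? f c xs (on ∘ there) (off ∘ there)))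
                       (≤-reflexive (sym (*-suc c _)))
... | no ¬px = subst (_≤ _) (cong (_+ sum (map f xs)) (sym (off (here refl) ¬px)))
                     (sum-selected-≤ S? f c xs (on ∘ there) (off ∘ there))

unique-⊆⇒length-≤ : {xs ys : List A} → Unique xs → xs ⊆ ys → length xs ≤ length ys
unique-⊆⇒length-≤ {xs = []} _ _ = z≤n
unique-⊆⇒length-≤ {xs = x ∷ xs} (x∉xs ∷ uxs) xs⊆ys with ∈-∃++ (xs⊆ys (here refl))
... | us , vs , refl = subst (suc (length xs) ≤_) (sym (trans (length-++ us) (+-suc (length us) (length vs))))
      (s≤s (subst (length xs ≤_) (length-++ us) (unique-⊆⇒length-≤ uxs xs⊆us++vs)))
  where
  xs⊆us++vs : xs ⊆ us ++ vs
  xs⊆us++vs {y} y∈xs with ∈-++⁻ us (xs⊆ys (there y∈xs))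
  ... | inj₁ y∈us = ∈-++⁺ˡ y∈us
  ... | inj₂ (here refl) = ⊥-elim (All.lookup x∉xs y∈xs refl)
  ... | inj₂ (there y∈vs) = ∈-++⁺ʳ us y∈vs

count≡suc⇒Any : {P : Pred A ℓ} (P? : Decidable P) (xs : List A) {c : ℕ} → count P? xs ≡ suc c → Any P xs
count≡suc⇒Any P? (x ∷ xs) eq with P? x
... | yes px = here px
... | no _ = there (count≡suc⇒Any P? xs eq)

length≡count+count : {P : Pred A ℓ} (P? : Decidable P) (xs : List A) → length xs ≡ count P? xs + count (¬? ∘ P?) xs
length≡count+count P? [] = refl
length≡count+count P? (x ∷ xs) with P? x
... | yes _ = cong suc (length≡count+count P? xs)
... | no _ = trans (cong suc (length≡count+count P? xs)) (sym (+-suc _ _))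

-- Pair counts and resolutions

module _ {v : ℕ} where
  open DecMembership (_≟_ {n = v}) using (_∈?_)

  inBoth? : (x y : Fin v) → Decidable (λ (B : Block v) → x ∈ B × y ∈ B)
  inBoth? x y B = (x ∈? B) ×-dec (y ∈? B)

  points-sharing-≤ : ∀ {k} (x : Fin v) (L : List (Block v)) {S : List (Fin v)} → Unique S →
    (∀ {y} → y ∈ S → y ≢ x × Any (λ B → x ∈ B × y ∈ B) L) → All (IsKSubset v (suc k)) L →
    length S ≤ k * pointCount x L
  points-sharing-≤ x [] {[]} _ _ _ = z≤n
  points-sharing-≤ x [] {y ∷ S} _ shares _ with shares (here refl)
  ... | _ , ()
  points-sharing-≤ {k} x (B ∷ L) {S} unique shares ((size , _) ∷ sizes) with x ∈? B
  ... | no x∉B = points-sharing-≤ x L unique (λ y∈S → proj₁ (shares y∈S) , notHere (proj₂ (shares y∈S))) sizes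
    where
    notHere : ∀ {y} → Any (λ B → x ∈ B × y ∈ B) (B ∷ L) → Any (λ B → x ∈ B × y ∈ B) L
    notHere (here (x∈B , _)) = ⊥-elim (x∉B x∈B)
    notHere (there any) = any
  ... | yes x∈B = subst (_≤ k * suc (pointCount x L)) (sym (length≡count+count (_∈? B) S))
      (≤-trans (+-mono-≤ inB outsideB) (≤-reflexive (sym (*-suc k _))))
    where
    inB : count (_∈? B) S ≤ k
    inB = ≤-pred (subst (suc (count (_∈? B) S) ≤_) size
            (unique-⊆⇒length-≤ (All.tabulate x≢ ∷ Unique.filter⁺ (_∈? B) unique) x∷S∩B⊆B))
      where
      x≢ : ∀ {y} → y ∈ filter (_∈? B) S → x ≢ y
      x≢ y∈ x≡y = proj₁ (shares (proj₁ (∈-filter⁻ (_∈? B) {xs = S} y∈))) (sym x≡y)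
      x∷S∩B⊆B : ∀ {y} → y ∈ x ∷ filter (_∈? B) S → y ∈ B
      x∷S∩B⊆B (here refl) = x∈B
      x∷S∩B⊆B (there y∈) = proj₂ (∈-filter⁻ (_∈? B) {xs = S} y∈)

    outsideB : count (¬? ∘ (_∈? B)) S ≤ k * pointCount x L
    outsideB = points-sharing-≤ x L (Unique.filter⁺ (¬? ∘ (_∈? B)) unique) sharesInL sizes
      where
      sharesInL : ∀ {y} → y ∈ filter (¬? ∘ (_∈? B)) S → y ≢ x × Any (λ B → x ∈ B × y ∈ B) L
      sharesInL y∈ with ∈-filter⁻ (¬? ∘ (_∈? B)) {xs = S} y∈
      ... | y∈S , y∉B with shares y∈S
      ... | y≢x , here (_ , y∈B) = ⊥-elim (y∉B y∈B)
      ... | y≢x , there any = y≢x , any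

  pointCount-concat : ∀ (x : Fin v) {Ps} → All (IsParallelClass v) Ps → pointCount x (concat Ps) ≡ length Ps
  pointCount-concat x [] = refl
  pointCount-concat x {P ∷ Ps} (parallel ∷ parallels) =
    trans (count-++ (x ∈?_) P (concat Ps)) (cong₂ _+_ (parallel x) (pointCount-concat x parallels))

resolution-length : ∀ {n k} (Ps : List (List (Block (suc n)))) → All (IsParallelClass (suc n)) Ps →
  IsBIBD (suc n) (suc k) 1 (concat Ps) → n ≤ k * length Ps
resolution-length {n} {k} Ps parallels (sizes , pairs) =
  subst₂ (λ l c → l ≤ k * c) (trans (length-map (punchIn zero) (allFin n)) (length-tabulate id))
    (pointCount-concat zero parallels)
    (points-sharing-≤ zero (concat Ps) (Unique.map⁺ (punchIn-injective zero _ _) (Unique.allFin⁺ n)) shares sizes)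
  where
  shares : ∀ {y} → y ∈ map (punchIn zero) (allFin n) → y ≢ zero × Any (λ B → zero ∈ B × y ∈ B) (concat Ps)
  shares y∈ with ∈-map⁻ (punchIn zero) y∈
  ... | z , _ , refl = punchInᵢ≢i zero z ,
        count≡suc⇒Any (inBoth? zero (punchIn zero z)) (concat Ps)
          (pairs zero (punchIn zero z) (punchInᵢ≢i zero z ∘ sym))

-- Nested designs and their gluing

Nested : ℕ → Set
Nested v = List (Fin v × Block v)

blocks : {v : ℕ} → Nested v → List (Block v)
blocks = map proj₂

augmentedBlocks : {v : ℕ} → Nested v → List (Block v)
augmentedBlocks = map (uncurry _∷_)

nesting : {v : ℕ} (D : Nested v) →
  Σ (Fin (length (blocks D)) → Fin v) λ φ → augment (blocks D) φ ≡ augmentedBlocks D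
nesting [] = (λ ()) , refl
nesting ((p , B) ∷ D) with nesting D
... | φ , eq = (λ { zero → p ; (suc i) → φ i }) , cong ((p ∷ B) ∷_) eq

-- Blocks of size k, index 1 and nested index at most 2; with singleton groups (group = id) this is
-- exactly a nested (v,k,1)-BIBD.
record IsNestedGDD {v g : ℕ} (k : ℕ) (group : Fin v → Fin g) (D : Nested v) : Set where
  field
    blocks-size    : All (IsKSubset v k) (blocks D)
    augmented-size : All (IsKSubset v (k + 1)) (augmentedBlocks D)
    within-group   : ∀ u w → u ≢ w → group u ≡ group w →
                     pairCount u w (blocks D) ≡ 0 × pairCount u w (augmentedBlocks D) ≡ 0
    across-groups  : ∀ u w → group u ≢ group w →
                     pairCount u w (blocks D) ≡ 1 × pairCount u w (augmentedBlocks D) ≤ 2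

isNestedGDD? : ∀ {v g} k (group : Fin v → Fin g) (D : Nested v) → Dec (IsNestedGDD k group D)
isNestedGDD? {v} k group D = map′
  (λ (s , s′ , w , a) → record { blocks-size = s ; augmented-size = s′ ; within-group = w ; across-groups = a })
  (λ G → let open IsNestedGDD G in blocks-size , augmented-size , within-group , across-groups)
  (All.all? (kSubset? k) (blocks D) ×-dec All.all? (kSubset? (k + 1)) (augmentedBlocks D) ×-dec
   (all? λ u → all? λ w → ¬? (u ≟ w) →-dec (group u ≟ group w →-dec
     (pairCount u w (blocks D) ℕ.≟ 0 ×-dec pairCount u w (augmentedBlocks D) ℕ.≟ 0))) ×-dec
   (all? λ u → all? λ w → ¬? (group u ≟ group w) →-dec
     (pairCount u w (blocks D) ℕ.≟ 1 ×-dec pairCount u w (augmentedBlocks D) ℕ.≤? 2)))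
  where
  kSubset? : ∀ k → Decidable (IsKSubset v k)
  kSubset? k B = length B ℕ.≟ k ×-dec UniqueDec.unique? _≟_ B

nestedGDD⇒nestedBIBD : ∀ {v k} {D : Nested v} → IsNestedGDD k id D → NestedBIBD v k 1
nestedGDD⇒nestedBIBD {v} {k} {D} G with nesting D
... | φ , eq = blocks D , (blocks-size , λ x y x≢y → proj₁ (across-groups x y x≢y)) ,
               φ , subst (IsPartialBIBD v (k + 1) 2) (sym eq)
                     (augmented-size , λ x y x≢y → proj₂ (across-groups x y x≢y))
  where open IsNestedGDD G

nestedBIBD⇒nestedGDD : ∀ {v k} → NestedBIBD v k 1 → Σ (Nested v) (IsNestedGDD k id)
nestedBIBD⇒nestedGDD {v} {k} (𝒜 , (sizes , pairs) , φ , (sizes′ , pairs′)) = D , record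
  { blocks-size    = subst (All (IsKSubset v k)) (sym blocks-D) sizes
  ; augmented-size = subst (All (IsKSubset v (k + 1))) (sym aug-D) sizes′
  ; within-group   = λ u w u≢w u≡w → ⊥-elim (u≢w u≡w)
  ; across-groups  = λ u w u≢w → subst (λ L → pairCount u w L ≡ 1) (sym blocks-D) (pairs u w u≢w) ,
                                 subst (λ L → pairCount u w L ≤ 2) (sym aug-D) (pairs′ u w u≢w)
  }
  where
  D : Nested v
  D = tabulate (λ i → φ i , lookup 𝒜 i)
  blocks-D : blocks D ≡ 𝒜
  blocks-D = trans (map-tabulate (λ i → φ i , lookup 𝒜 i) proj₂) (tabulate-lookup 𝒜)
  aug-D : augmentedBlocks D ≡ augment 𝒜 φ
  aug-D = map-tabulate (λ i → φ i , lookup 𝒜 i) (uncurry _∷_)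

module _ {n V : ℕ} (f : Fin n → Fin V) where

  embedBlocks : List (Block n) → List (Block V)
  embedBlocks = map (map f)

  embedNested : Nested n → Nested V
  embedNested = map (Product.map f (map f))

  blocks-embedNested : ∀ D → blocks (embedNested D) ≡ embedBlocks (blocks D)
  blocks-embedNested D = trans (sym (map-∘ D)) (map-∘ D)

  augmentedBlocks-embedNested : ∀ D → augmentedBlocks (embedNested D) ≡ embedBlocks (augmentedBlocks D)
  augmentedBlocks-embedNested D = trans (sym (map-∘ D)) (map-∘ D)

  embedBlocks-kSubsets : Injective _≡_ _≡_ f → ∀ {k Bs} →
    All (IsKSubset n k) Bs → All (IsKSubset V k) (embedBlocks Bs)
  embedBlocks-kSubsets f-inj = All.map⁺ ∘ All.map λ {B} (size , unique) →
    trans (length-map f B) size , Unique.map⁺ f-inj unique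

  pairCount-embedBlocks : Injective _≡_ _≡_ f → ∀ u w Bs →
    pairCount (f u) (f w) (embedBlocks Bs) ≡ pairCount u w Bs
  pairCount-embedBlocks f-inj u w Bs =
    trans (count-map (inBoth? (f u) (f w)) (map f) Bs)
          (count-≐ _ (inBoth? u w) (Product.map unmap unmap , Product.map (∈-map⁺ f) (∈-map⁺ f)) Bs)
    where
    unmap : ∀ {x B} → f x ∈ map f B → x ∈ B
    unmap fx∈ with ∈-map⁻ f fx∈
    ... | _ , x′∈B , fx≡fx′ = subst (_∈ _) (sym (f-inj fx≡fx′)) x′∈B

  pairCount-embedBlocks-zero : ∀ p q Bs → (∀ u w → f u ≡ p → f w ≡ q → pairCount u w Bs ≡ 0) →
    pairCount p q (embedBlocks Bs) ≡ 0
  pairCount-embedBlocks-zero p q Bs no-pair = count-none (inBoth? p q) (All.tabulate nonePairs)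
    where
    nonePairs : ∀ {B′} → B′ ∈ embedBlocks Bs → ¬ (p ∈ B′ × q ∈ B′)
    nonePairs B′∈ (p∈ , q∈) with ∈-map⁻ (map f) B′∈
    ... | B , B∈Bs , refl with ∈-map⁻ f p∈ | ∈-map⁻ f q∈
    ... | u , u∈B , refl | w , w∈B , refl =
      count≡0⇒∉ (inBoth? u w) (no-pair u w refl refl) B∈Bs (u∈B , w∈B)

record Component (Pt : Set) : Set where
  field
    size groups : ℕ
    group       : Fin size → Fin groups
    design      : Nested size
    embed       : Fin size → Pt

  Image : Pt → Set
  Image P = ∃ λ u → embed u ≡ P

  Covers : Pt → Pt → Set
  Covers P Q = ∃₂ λ u w → embed u ≡ P × embed w ≡ Q × group u ≢ group w

  Misses : Pt → Pt → Set
  Misses P Q = ∀ u w → embed u ≡ P → embed w ≡ Q → group u ≡ group w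

  -- For components whose groups are the fibres of κ on the image of embed.
  module _ {G : Set} (κ : Pt → G) {P Q : Pt} where

    covers-by : (∀ {u w} → group u ≡ group w → κ (embed u) ≡ κ (embed w)) →
      Image P → Image Q → κ P ≢ κ Q → Covers P Q
    covers-by κ-resp (u , refl) (w , refl) κ≢ = u , w , refl , refl , κ≢ ∘ κ-resp

    misses-by : (∀ {u w} → κ (embed u) ≡ κ (embed w) → group u ≡ group w) →
      (Image P → Image Q → κ P ≡ κ Q) → Misses P Q
    misses-by κ-reflects same u w refl refl = κ-reflects (same (u , refl) (w , refl))

  covers-sym : ∀ {P Q} → Covers P Q → Covers Q P
  covers-sym (u , w , eu , ew , groups≢) = w , u , ew , eu , groups≢ ∘ sym

  misses-sym : ∀ {P Q} → Misses P Q → Misses Q P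
  misses-sym misses u w eu ew = sym (misses w u ew eu)

module Gluing {Pt : Set} {V : ℕ} (Pt↔Fin : Pt ↔ Fin V) (k : ℕ) where
  open Inverse Pt↔Fin using (strictlyInverseˡ; strictlyInverseʳ) renaming (to to enc; from to dec)
  open Component

  enc-injective : Injective _≡_ _≡_ enc
  enc-injective {P} {Q} eq = trans (sym (strictlyInverseʳ P)) (trans (cong dec eq) (strictlyInverseʳ Q))

  dec-injective : Injective _≡_ _≡_ dec
  dec-injective {p} {q} eq = trans (sym (strictlyInverseˡ p)) (trans (cong enc eq) (strictlyInverseˡ q))

  IsEmbeddedGDD : Component Pt → Set
  IsEmbeddedGDD c = IsNestedGDD k (group c) (design c) × Injective _≡_ _≡_ (embed c)

  image : Component Pt → Nested V
  image c = embedNested (enc ∘ embed c) (design c)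

  module _ (c : Component Pt) (embedded : IsEmbeddedGDD c) where
    open IsNestedGDD (proj₁ embedded)

    enc∘embed-injective : Injective _≡_ _≡_ (enc ∘ embed c)
    enc∘embed-injective = proj₂ embedded ∘ enc-injective

    image-sizes : All (IsKSubset V k) (blocks (image c)) × All (IsKSubset V (k + 1)) (augmentedBlocks (image c))
    image-sizes =
      subst (All _) (sym (blocks-embedNested _ (design c)))
        (embedBlocks-kSubsets _ enc∘embed-injective blocks-size) ,
      subst (All _) (sym (augmentedBlocks-embedNested _ (design c)))
        (embedBlocks-kSubsets _ enc∘embed-injective augmented-size)

    module _ {P Q : Pt} (P≢Q : P ≢ Q) where
      covered-pairCounts : Covers c P Q →
        pairCount (enc P) (enc Q) (blocks (image c)) ≡ 1 × pairCount (enc P) (enc Q) (augmentedBlocks (image c)) ≤ 2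
      covered-pairCounts (u , w , refl , refl , groups≢) =
        trans (cong (pairCount _ _) (blocks-embedNested _ (design c)))
              (trans (pairCount-embedBlocks _ enc∘embed-injective u w (blocks (design c)))
                     (proj₁ (across-groups u w groups≢))) ,
        subst (_≤ 2) (sym (trans (cong (pairCount _ _) (augmentedBlocks-embedNested _ (design c)))
                                (pairCount-embedBlocks _ enc∘embed-injective u w (augmentedBlocks (design c)))))
              (proj₂ (across-groups u w groups≢))

      missed-pairCounts : Misses c P Q →
        pairCount (enc P) (enc Q) (blocks (image c)) ≡ 0 × pairCount (enc P) (enc Q) (augmentedBlocks (image c)) ≡ 0
      missed-pairCounts misses =
        trans (cong (pairCount _ _) (blocks-embedNested _ (design c)))
              (pairCount-embedBlocks-zero _ _ _ (blocks (design c)) λ u w eu ew → proj₁ (within u w eu ew)) ,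
        trans (cong (pairCount _ _) (augmentedBlocks-embedNested _ (design c)))
              (pairCount-embedBlocks-zero _ _ _ (augmentedBlocks (design c)) λ u w eu ew → proj₂ (within u w eu ew))
        where
        within : ∀ u w → enc (embed c u) ≡ enc P → enc (embed c w) ≡ enc Q →
          pairCount u w (blocks (design c)) ≡ 0 × pairCount u w (augmentedBlocks (design c)) ≡ 0
        within u w eu ew with enc-injective eu | enc-injective ew
        ... | refl | refl = within-group u w (λ { refl → P≢Q refl }) (misses u w refl refl)

  record Selection {A : Set} (component : A → Component Pt) (as : List A) (P Q : Pt) : Set₁ where
    field
      Selected    : Pred A 0ℓ
      selected?   : Decidable Selected
      exactly-one : count selected? as ≡ 1
      covers      : ∀ {a} → a ∈ as → Selected a → Covers (component a) P Q
      misses      : ∀ {a} → a ∈ as → ¬ Selected a → Misses (component a) P Q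

  Selection-sym : ∀ {A} {component : A → Component Pt} {as P Q} →
    Selection component as P Q → Selection component as Q P
  Selection-sym {component = component} s = record
    { Selected    = Selected
    ; selected?   = selected?
    ; exactly-one = exactly-one
    ; covers      = λ a∈ sel → covers-sym (component _) (covers a∈ sel)
    ; misses      = λ a∈ ¬sel → misses-sym (component _) (misses a∈ ¬sel)
    }
    where open Selection s

  module _ {A : Set} (component : A → Component Pt) (as : List A)
           (embedded : ∀ {a} → a ∈ as → IsEmbeddedGDD (component a))
           (select : ∀ P Q → P ≢ Q → Selection component as P Q) where

    glued : Nested V
    glued = concatMap (image ∘ component) as

    pairCount-glued : ∀ (h : Fin V × Block V → Block V) p q →
      pairCount p q (map h glued) ≡ sum (map (pairCount p q ∘ map h ∘ image ∘ component) as)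
    pairCount-glued h p q =
      trans (cong (pairCount p q) (map-concatMap h (image ∘ component) as))
            (count-concatMap (inBoth? p q) (map h ∘ image ∘ component) as)

    glued-pairCounts : ∀ P Q → P ≢ Q →
      pairCount (enc P) (enc Q) (blocks glued) ≡ 1 × pairCount (enc P) (enc Q) (augmentedBlocks glued) ≤ 2
    glued-pairCounts P Q P≢Q =
      trans (pairCount-glued proj₂ (enc P) (enc Q))
        (trans (sum-selected selected? _ 1 as (proj₁ ∘₂ covered) (proj₁ ∘₂ missed))
               (cong (1 *_) exactly-one)) ,
      subst (_≤ 2) (sym (pairCount-glued (uncurry _∷_) (enc P) (enc Q)))
        (≤-trans (sum-selected-≤ selected? _ 2 as (proj₂ ∘₂ covered) (proj₂ ∘₂ missed))
                 (≤-reflexive (cong (2 *_) exactly-one)))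
      where
      open Selection (select P Q P≢Q)

      covered : ∀ {a} → a ∈ as → Selected a →
        pairCount (enc P) (enc Q) (blocks (image (component a))) ≡ 1 ×
        pairCount (enc P) (enc Q) (augmentedBlocks (image (component a))) ≤ 2
      covered {a} a∈ sel = covered-pairCounts (component a) (embedded a∈) P≢Q (covers a∈ sel)

      missed : ∀ {a} → a ∈ as → ¬ Selected a →
        pairCount (enc P) (enc Q) (blocks (image (component a))) ≡ 0 ×
        pairCount (enc P) (enc Q) (augmentedBlocks (image (component a))) ≡ 0
      missed {a} a∈ ¬sel = missed-pairCounts (component a) (embedded a∈) P≢Q (misses a∈ ¬sel)

    glued-isNestedGDD : IsNestedGDD k id glued
    glued-isNestedGDD = record
      { blocks-size    = subst (All _) (sym (map-concatMap proj₂ (image ∘ component) as))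
                           (All.concat⁺ (All.map⁺ (All.tabulate λ a∈ → proj₁ (image-sizes _ (embedded a∈)))))
      ; augmented-size = subst (All _) (sym (map-concatMap (uncurry _∷_) (image ∘ component) as))
                           (All.concat⁺ (All.map⁺ (All.tabulate λ a∈ → proj₂ (image-sizes _ (embedded a∈)))))
      ; within-group   = λ u w u≢w u≡w → ⊥-elim (u≢w u≡w)
      ; across-groups  = λ p q p≢q →
          subst₂ (λ p q → pairCount p q (blocks glued) ≡ 1 × pairCount p q (augmentedBlocks glued) ≤ 2)
            (strictlyInverseˡ p) (strictlyInverseˡ q) (glued-pairCounts (dec p) (dec q) (p≢q ∘ dec-injective))
      }

-- The construction

-- Small designs found by computer.  Point u lies in group ⌊u/3⌋; in the 3⁹ design group 0 is the one
-- placed on Yᵢ, and point 0 of the 25-point design is ∞.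
opaque
  nestedGDD3⁸ : Nested (8 * 3)
  nestedGDD3⁸ =
    (# 7 , # 21 ∷ # 0 ∷ # 4 ∷ # 11 ∷ []) ∷ (# 13 , # 0 ∷ # 3 ∷ # 8 ∷ # 15 ∷ []) ∷ (# 8 , # 22 ∷ # 1 ∷ # 5 ∷ # 9 ∷ []) ∷
    (# 14 , # 1 ∷ # 4 ∷ # 6 ∷ # 16 ∷ []) ∷ (# 6 , # 23 ∷ # 2 ∷ # 3 ∷ # 10 ∷ []) ∷ (# 12 , # 2 ∷ # 5 ∷ # 7 ∷ # 17 ∷ []) ∷
    (# 10 , # 21 ∷ # 3 ∷ # 7 ∷ # 14 ∷ []) ∷ (# 16 , # 3 ∷ # 6 ∷ # 11 ∷ # 18 ∷ []) ∷ (# 11 , # 22 ∷ # 4 ∷ # 8 ∷ # 12 ∷ []) ∷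
    (# 17 , # 4 ∷ # 7 ∷ # 9 ∷ # 19 ∷ []) ∷ (# 9 , # 23 ∷ # 5 ∷ # 6 ∷ # 13 ∷ []) ∷ (# 15 , # 5 ∷ # 8 ∷ # 10 ∷ # 20 ∷ []) ∷
    (# 13 , # 21 ∷ # 6 ∷ # 10 ∷ # 17 ∷ []) ∷ (# 19 , # 6 ∷ # 9 ∷ # 14 ∷ # 0 ∷ []) ∷ (# 14 , # 22 ∷ # 7 ∷ # 11 ∷ # 15 ∷ []) ∷
    (# 20 , # 7 ∷ # 10 ∷ # 12 ∷ # 1 ∷ []) ∷ (# 12 , # 23 ∷ # 8 ∷ # 9 ∷ # 16 ∷ []) ∷ (# 18 , # 8 ∷ # 11 ∷ # 13 ∷ # 2 ∷ []) ∷
    (# 16 , # 21 ∷ # 9 ∷ # 13 ∷ # 20 ∷ []) ∷ (# 1 , # 9 ∷ # 12 ∷ # 17 ∷ # 3 ∷ []) ∷ (# 17 , # 22 ∷ # 10 ∷ # 14 ∷ # 18 ∷ []) ∷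
    (# 2 , # 10 ∷ # 13 ∷ # 15 ∷ # 4 ∷ []) ∷ (# 15 , # 23 ∷ # 11 ∷ # 12 ∷ # 19 ∷ []) ∷ (# 0 , # 11 ∷ # 14 ∷ # 16 ∷ # 5 ∷ []) ∷
    (# 19 , # 21 ∷ # 12 ∷ # 16 ∷ # 2 ∷ []) ∷ (# 4 , # 12 ∷ # 15 ∷ # 20 ∷ # 6 ∷ []) ∷ (# 20 , # 22 ∷ # 13 ∷ # 17 ∷ # 0 ∷ []) ∷
    (# 5 , # 13 ∷ # 16 ∷ # 18 ∷ # 7 ∷ []) ∷ (# 18 , # 23 ∷ # 14 ∷ # 15 ∷ # 1 ∷ []) ∷ (# 3 , # 14 ∷ # 17 ∷ # 19 ∷ # 8 ∷ []) ∷
    (# 1 , # 21 ∷ # 15 ∷ # 19 ∷ # 5 ∷ []) ∷ (# 7 , # 15 ∷ # 18 ∷ # 2 ∷ # 9 ∷ []) ∷ (# 2 , # 22 ∷ # 16 ∷ # 20 ∷ # 3 ∷ []) ∷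
    (# 8 , # 16 ∷ # 19 ∷ # 0 ∷ # 10 ∷ []) ∷ (# 0 , # 23 ∷ # 17 ∷ # 18 ∷ # 4 ∷ []) ∷ (# 6 , # 17 ∷ # 20 ∷ # 1 ∷ # 11 ∷ []) ∷
    (# 4 , # 21 ∷ # 18 ∷ # 1 ∷ # 8 ∷ []) ∷ (# 10 , # 18 ∷ # 0 ∷ # 5 ∷ # 12 ∷ []) ∷ (# 5 , # 22 ∷ # 19 ∷ # 2 ∷ # 6 ∷ []) ∷
    (# 11 , # 19 ∷ # 1 ∷ # 3 ∷ # 13 ∷ []) ∷ (# 3 , # 23 ∷ # 20 ∷ # 0 ∷ # 7 ∷ []) ∷ (# 9 , # 20 ∷ # 2 ∷ # 4 ∷ # 14 ∷ []) ∷ []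

opaque
  unfolding nestedGDD3⁸
  nestedGDD3⁸-isNestedGDD : IsNestedGDD 4 (quotient {8} 3) nestedGDD3⁸
  nestedGDD3⁸-isNestedGDD = from-yes (isNestedGDD? 4 (quotient {8} 3) nestedGDD3⁸)

opaque
  nestedGDD3⁹ : Nested (9 * 3)
  nestedGDD3⁹ =
    (# 1 , # 3 ∷ # 6 ∷ # 12 ∷ # 16 ∷ []) ∷ (# 9 , # 3 ∷ # 8 ∷ # 19 ∷ # 0 ∷ []) ∷ (# 2 , # 4 ∷ # 7 ∷ # 13 ∷ # 17 ∷ []) ∷
    (# 10 , # 4 ∷ # 6 ∷ # 20 ∷ # 1 ∷ []) ∷ (# 0 , # 5 ∷ # 8 ∷ # 14 ∷ # 15 ∷ []) ∷ (# 11 , # 5 ∷ # 7 ∷ # 18 ∷ # 2 ∷ []) ∷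
    (# 22 , # 6 ∷ # 9 ∷ # 15 ∷ # 19 ∷ []) ∷ (# 3 , # 6 ∷ # 11 ∷ # 13 ∷ # 21 ∷ []) ∷ (# 23 , # 7 ∷ # 10 ∷ # 16 ∷ # 20 ∷ []) ∷
    (# 4 , # 7 ∷ # 9 ∷ # 14 ∷ # 22 ∷ []) ∷ (# 21 , # 8 ∷ # 11 ∷ # 17 ∷ # 18 ∷ []) ∷ (# 5 , # 8 ∷ # 10 ∷ # 12 ∷ # 23 ∷ []) ∷
    (# 25 , # 9 ∷ # 3 ∷ # 18 ∷ # 13 ∷ []) ∷ (# 6 , # 9 ∷ # 5 ∷ # 16 ∷ # 24 ∷ []) ∷ (# 26 , # 10 ∷ # 4 ∷ # 19 ∷ # 14 ∷ []) ∷
    (# 7 , # 10 ∷ # 3 ∷ # 17 ∷ # 25 ∷ []) ∷ (# 24 , # 11 ∷ # 5 ∷ # 20 ∷ # 12 ∷ []) ∷ (# 8 , # 11 ∷ # 4 ∷ # 15 ∷ # 26 ∷ []) ∷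
    (# 10 , # 12 ∷ # 15 ∷ # 21 ∷ # 25 ∷ []) ∷ (# 18 , # 12 ∷ # 17 ∷ # 1 ∷ # 9 ∷ []) ∷ (# 11 , # 13 ∷ # 16 ∷ # 22 ∷ # 26 ∷ []) ∷
    (# 19 , # 13 ∷ # 15 ∷ # 2 ∷ # 10 ∷ []) ∷ (# 9 , # 14 ∷ # 17 ∷ # 23 ∷ # 24 ∷ []) ∷ (# 20 , # 14 ∷ # 16 ∷ # 0 ∷ # 11 ∷ []) ∷
    (# 4 , # 15 ∷ # 18 ∷ # 24 ∷ # 1 ∷ []) ∷ (# 12 , # 15 ∷ # 20 ∷ # 22 ∷ # 3 ∷ []) ∷ (# 5 , # 16 ∷ # 19 ∷ # 25 ∷ # 2 ∷ []) ∷
    (# 13 , # 16 ∷ # 18 ∷ # 23 ∷ # 4 ∷ []) ∷ (# 3 , # 17 ∷ # 20 ∷ # 26 ∷ # 0 ∷ []) ∷ (# 14 , # 17 ∷ # 19 ∷ # 21 ∷ # 5 ∷ []) ∷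
    (# 7 , # 18 ∷ # 12 ∷ # 0 ∷ # 22 ∷ []) ∷ (# 15 , # 18 ∷ # 14 ∷ # 25 ∷ # 6 ∷ []) ∷ (# 8 , # 19 ∷ # 13 ∷ # 1 ∷ # 23 ∷ []) ∷
    (# 16 , # 19 ∷ # 12 ∷ # 26 ∷ # 7 ∷ []) ∷ (# 6 , # 20 ∷ # 14 ∷ # 2 ∷ # 21 ∷ []) ∷ (# 17 , # 20 ∷ # 13 ∷ # 24 ∷ # 8 ∷ []) ∷
    (# 19 , # 21 ∷ # 24 ∷ # 3 ∷ # 7 ∷ []) ∷ (# 0 , # 21 ∷ # 26 ∷ # 10 ∷ # 18 ∷ []) ∷ (# 20 , # 22 ∷ # 25 ∷ # 4 ∷ # 8 ∷ []) ∷
    (# 1 , # 22 ∷ # 24 ∷ # 11 ∷ # 19 ∷ []) ∷ (# 18 , # 23 ∷ # 26 ∷ # 5 ∷ # 6 ∷ []) ∷ (# 2 , # 23 ∷ # 25 ∷ # 9 ∷ # 20 ∷ []) ∷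
    (# 13 , # 24 ∷ # 0 ∷ # 6 ∷ # 10 ∷ []) ∷ (# 21 , # 24 ∷ # 2 ∷ # 4 ∷ # 12 ∷ []) ∷ (# 14 , # 25 ∷ # 1 ∷ # 7 ∷ # 11 ∷ []) ∷
    (# 22 , # 25 ∷ # 0 ∷ # 5 ∷ # 13 ∷ []) ∷ (# 12 , # 26 ∷ # 2 ∷ # 8 ∷ # 9 ∷ []) ∷ (# 23 , # 26 ∷ # 1 ∷ # 3 ∷ # 14 ∷ []) ∷
    (# 16 , # 0 ∷ # 21 ∷ # 9 ∷ # 4 ∷ []) ∷ (# 24 , # 0 ∷ # 23 ∷ # 7 ∷ # 15 ∷ []) ∷ (# 17 , # 1 ∷ # 22 ∷ # 10 ∷ # 5 ∷ []) ∷
    (# 25 , # 1 ∷ # 21 ∷ # 8 ∷ # 16 ∷ []) ∷ (# 15 , # 2 ∷ # 23 ∷ # 11 ∷ # 3 ∷ []) ∷ (# 26 , # 2 ∷ # 22 ∷ # 6 ∷ # 17 ∷ []) ∷ []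

opaque
  unfolding nestedGDD3⁹
  nestedGDD3⁹-isNestedGDD : IsNestedGDD 4 (quotient {9} 3) nestedGDD3⁹
  nestedGDD3⁹-isNestedGDD = from-yes (isNestedGDD? 4 (quotient {9} 3) nestedGDD3⁹)

opaque
  nestedBIBD25 : Nested 25
  nestedBIBD25 =
    (# 3 , # 1 ∷ # 2 ∷ # 6 ∷ # 13 ∷ []) ∷ (# 14 , # 1 ∷ # 3 ∷ # 9 ∷ # 18 ∷ []) ∷ (# 4 , # 2 ∷ # 3 ∷ # 7 ∷ # 14 ∷ []) ∷
    (# 15 , # 2 ∷ # 4 ∷ # 10 ∷ # 19 ∷ []) ∷ (# 5 , # 3 ∷ # 4 ∷ # 8 ∷ # 15 ∷ []) ∷ (# 11 , # 3 ∷ # 5 ∷ # 6 ∷ # 20 ∷ []) ∷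
    (# 1 , # 4 ∷ # 5 ∷ # 9 ∷ # 11 ∷ []) ∷ (# 12 , # 4 ∷ # 1 ∷ # 7 ∷ # 16 ∷ []) ∷ (# 2 , # 5 ∷ # 1 ∷ # 10 ∷ # 12 ∷ []) ∷
    (# 13 , # 5 ∷ # 2 ∷ # 8 ∷ # 17 ∷ []) ∷ (# 8 , # 6 ∷ # 7 ∷ # 11 ∷ # 18 ∷ []) ∷ (# 19 , # 6 ∷ # 8 ∷ # 14 ∷ # 23 ∷ []) ∷
    (# 9 , # 7 ∷ # 8 ∷ # 12 ∷ # 19 ∷ []) ∷ (# 20 , # 7 ∷ # 9 ∷ # 15 ∷ # 24 ∷ []) ∷ (# 10 , # 8 ∷ # 9 ∷ # 13 ∷ # 20 ∷ []) ∷
    (# 16 , # 8 ∷ # 10 ∷ # 11 ∷ # 0 ∷ []) ∷ (# 6 , # 9 ∷ # 10 ∷ # 14 ∷ # 16 ∷ []) ∷ (# 17 , # 9 ∷ # 6 ∷ # 12 ∷ # 21 ∷ []) ∷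
    (# 7 , # 10 ∷ # 6 ∷ # 15 ∷ # 17 ∷ []) ∷ (# 18 , # 10 ∷ # 7 ∷ # 13 ∷ # 22 ∷ []) ∷ (# 13 , # 11 ∷ # 12 ∷ # 16 ∷ # 23 ∷ []) ∷
    (# 24 , # 11 ∷ # 13 ∷ # 19 ∷ # 3 ∷ []) ∷ (# 14 , # 12 ∷ # 13 ∷ # 17 ∷ # 24 ∷ []) ∷ (# 0 , # 12 ∷ # 14 ∷ # 20 ∷ # 4 ∷ []) ∷
    (# 15 , # 13 ∷ # 14 ∷ # 18 ∷ # 0 ∷ []) ∷ (# 21 , # 13 ∷ # 15 ∷ # 16 ∷ # 5 ∷ []) ∷ (# 11 , # 14 ∷ # 15 ∷ # 19 ∷ # 21 ∷ []) ∷
    (# 22 , # 14 ∷ # 11 ∷ # 17 ∷ # 1 ∷ []) ∷ (# 12 , # 15 ∷ # 11 ∷ # 20 ∷ # 22 ∷ []) ∷ (# 23 , # 15 ∷ # 12 ∷ # 18 ∷ # 2 ∷ []) ∷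
    (# 18 , # 16 ∷ # 17 ∷ # 21 ∷ # 3 ∷ []) ∷ (# 4 , # 16 ∷ # 18 ∷ # 24 ∷ # 8 ∷ []) ∷ (# 19 , # 17 ∷ # 18 ∷ # 22 ∷ # 4 ∷ []) ∷
    (# 5 , # 17 ∷ # 19 ∷ # 0 ∷ # 9 ∷ []) ∷ (# 20 , # 18 ∷ # 19 ∷ # 23 ∷ # 5 ∷ []) ∷ (# 1 , # 18 ∷ # 20 ∷ # 21 ∷ # 10 ∷ []) ∷
    (# 16 , # 19 ∷ # 20 ∷ # 24 ∷ # 1 ∷ []) ∷ (# 2 , # 19 ∷ # 16 ∷ # 22 ∷ # 6 ∷ []) ∷ (# 17 , # 20 ∷ # 16 ∷ # 0 ∷ # 2 ∷ []) ∷
    (# 3 , # 20 ∷ # 17 ∷ # 23 ∷ # 7 ∷ []) ∷ (# 23 , # 21 ∷ # 22 ∷ # 1 ∷ # 8 ∷ []) ∷ (# 9 , # 21 ∷ # 23 ∷ # 4 ∷ # 13 ∷ []) ∷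
    (# 24 , # 22 ∷ # 23 ∷ # 2 ∷ # 9 ∷ []) ∷ (# 10 , # 22 ∷ # 24 ∷ # 5 ∷ # 14 ∷ []) ∷ (# 0 , # 23 ∷ # 24 ∷ # 3 ∷ # 10 ∷ []) ∷
    (# 6 , # 23 ∷ # 0 ∷ # 1 ∷ # 15 ∷ []) ∷ (# 21 , # 24 ∷ # 0 ∷ # 4 ∷ # 6 ∷ []) ∷ (# 7 , # 24 ∷ # 21 ∷ # 2 ∷ # 11 ∷ []) ∷
    (# 22 , # 0 ∷ # 21 ∷ # 5 ∷ # 7 ∷ []) ∷ (# 8 , # 0 ∷ # 22 ∷ # 3 ∷ # 12 ∷ []) ∷ []

opaque
  unfolding nestedBIBD25
  nestedBIBD25-isNestedGDD : IsNestedGDD 4 id nestedBIBD25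
  nestedBIBD25-isNestedGDD = from-yes (isNestedGDD? 4 id nestedBIBD25)

-- The k-th entry of a list, with the junk value x₀ past its end.
nth : A → List A → ℕ → A
nth x₀ [] _ = x₀
nth x₀ (x ∷ xs) zero = x
nth x₀ (x ∷ xs) (suc k) = nth x₀ xs k

nth-∈ : ∀ (x₀ : A) {xs k} → k < length xs → nth x₀ xs k ∈ xs
nth-∈ x₀ {_ ∷ _} {zero} _ = here refl
nth-∈ x₀ {_ ∷ xs} {suc k} (s≤s k<) = there (nth-∈ x₀ k<)

∈⇒nth : ∀ (x₀ : A) {xs x} → x ∈ xs → ∃ λ k → k < length xs × nth x₀ xs k ≡ x
∈⇒nth x₀ (here refl) = zero , s≤s z≤n , refl
∈⇒nth x₀ (there x∈) with ∈⇒nth x₀ x∈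
... | k , k< , eq = suc k , s≤s k< , eq

nth-injective : ∀ (x₀ : A) {xs k k′} → Unique xs → k < length xs → k′ < length xs →
  nth x₀ xs k ≡ nth x₀ xs k′ → k ≡ k′
nth-injective x₀ {_ ∷ _} {zero} {zero} _ _ _ _ = refl
nth-injective x₀ {_ ∷ xs} {zero} {suc k′} (x∉ ∷ _) _ (s≤s k′<) eq = ⊥-elim (All.lookup x∉ (nth-∈ x₀ k′<) eq)
nth-injective x₀ {_ ∷ xs} {suc k} {zero} (x∉ ∷ _) (s≤s k<) _ eq = ⊥-elim (All.lookup x∉ (nth-∈ x₀ k<) (sym eq))
nth-injective x₀ {_ ∷ xs} {suc k} {suc k′} (_ ∷ unique) (s≤s k<) (s≤s k′<) eq =
  cong suc (nth-injective x₀ unique k< k′< eq)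

module Construction (n t : ℕ) where

  -- |X| = n + 1, so that zero is available as junk value for nth.
  N : ℕ
  N = suc n

  _‼_ : Block N → Fin 8 → Fin N
  B ‼ k = nth zero B (toℕ k)

  module _ {B : Block N} (kB : IsKSubset N 8 B) where

    private
      bound : ∀ k → toℕ k < length B
      bound k = subst (toℕ k <_) (sym (proj₁ kB)) (toℕ<n k)

    ‼-∈ : ∀ k → B ‼ k ∈ B
    ‼-∈ k = nth-∈ zero (bound k)

    ∈⇒‼ : ∀ {x} → x ∈ B → ∃ λ k → B ‼ k ≡ x
    ∈⇒‼ x∈ with ∈⇒nth zero x∈
    ... | k , k< , eq = fromℕ< (subst (k <_) (proj₁ kB) k<) , trans (cong (nth zero B) (toℕ-fromℕ< _)) eq

    ‼-injective : Injective _≡_ _≡_ (B ‼_)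
    ‼-injective eq = toℕ-injective (nth-injective zero (proj₂ kB) (bound _) (bound _) eq)

  data Group : Set where
    X : Fin N → Group
    Y : Fin t → Group

  -- pt (X x) a is (x, a) ∈ X × ℤ₃, and pt (Y i) a is the a-th point of Yᵢ.
  data Point : Set where
    pt : Group → Fin 3 → Point
    ∞  : Point

  V : ℕ
  V = N * 3 + suc (t * 3)

  encode : Point → Fin V
  encode (pt (X x) a) = combine x a ↑ˡ suc (t * 3)
  encode (pt (Y i) a) = (N * 3) ↑ʳ suc (combine i a)
  encode ∞            = (N * 3) ↑ʳ zero

  decode : Fin V → Point
  decode p with splitAt (N * 3) p
  ... | inj₁ u       = pt (X (quotient 3 u)) (remainder {N} 3 u)
  ... | inj₂ zero    = ∞
  ... | inj₂ (suc v) = pt (Y (quotient 3 v)) (remainder {t} 3 v)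

  decode-encode : ∀ P → decode (encode P) ≡ P
  decode-encode (pt (X x) a) rewrite splitAt-↑ˡ (N * 3) (combine x a) (suc (t * 3)) =
    cong (λ (x , a) → pt (X x) a) (remQuot-combine x a)
  decode-encode (pt (Y i) a) rewrite splitAt-↑ʳ (N * 3) (suc (t * 3)) (suc (combine i a)) =
    cong (λ (i , a) → pt (Y i) a) (remQuot-combine i a)
  decode-encode ∞ rewrite splitAt-↑ʳ (N * 3) (suc (t * 3)) zero = refl

  encode-decode : ∀ p → encode (decode p) ≡ p
  encode-decode p with splitAt (N * 3) p in eq
  ... | inj₁ u = trans (cong (_↑ˡ suc (t * 3)) (combine-remQuot {N} 3 u)) joined
    where joined = trans (cong (join _ _) (sym eq)) (join-splitAt (N * 3) (suc (t * 3)) p)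
  ... | inj₂ zero = trans (cong (join _ _) (sym eq)) (join-splitAt (N * 3) (suc (t * 3)) p)
  ... | inj₂ (suc v) = trans (cong (λ v → (N * 3) ↑ʳ suc v) (combine-remQuot {t} 3 v))
                             (trans (cong (join _ _) (sym eq)) (join-splitAt (N * 3) (suc (t * 3)) p))

  Point↔Fin : Point ↔ Fin V
  Point↔Fin = mk↔ₛ′ encode decode encode-decode decode-encode

  groupOf : Point → Maybe Group
  groupOf (pt G _) = just G
  groupOf ∞        = nothing

  pt-injective : ∀ {G G′ a a′} → pt G a ≡ pt G′ a′ → G ≡ G′ × a ≡ a′
  pt-injective refl = refl , refl

  module _ {g : ℕ} (groupAt : Fin g → Group) where

    -- Point combine k a = 3k + a of a small design goes to level a of the group groupAt k.
    layer : Fin (g * 3) → Point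
    layer u = pt (groupAt (quotient 3 u)) (remainder {g} 3 u)

    pointed : Fin (suc (g * 3)) → Point
    pointed zero    = ∞
    pointed (suc u) = layer u

    layer-combine : ∀ k a → layer (combine k a) ≡ pt (groupAt k) a
    layer-combine k a = cong (λ (k , a) → pt (groupAt k) a) (remQuot-combine k a)

    layer≢∞ : ∀ u → layer u ≢ ∞
    layer≢∞ u ()

    layer-image⁻ : ∀ u {G a} → layer u ≡ pt G a → ∃ λ k → groupAt k ≡ G
    layer-image⁻ u eq = quotient 3 u , proj₁ (pt-injective eq)

    pointed-image⁻ : ∀ u {G a} → pointed u ≡ pt G a → ∃ λ k → groupAt k ≡ G
    pointed-image⁻ (suc u) eq = layer-image⁻ u eq

    module _ (groupAt-injective : Injective _≡_ _≡_ groupAt) where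

      layer-injective : Injective _≡_ _≡_ layer
      layer-injective {u} {w} eq with pt-injective eq
      ... | G≡ , a≡ = trans (sym (combine-remQuot {g} 3 u))
                        (trans (cong₂ combine (groupAt-injective G≡) a≡) (combine-remQuot {g} 3 w))

      pointed-injective : Injective _≡_ _≡_ pointed
      pointed-injective {zero} {zero} _ = refl
      pointed-injective {suc u} {suc w} eq = cong suc (layer-injective eq)
      pointed-injective {zero} {suc w} ()
      pointed-injective {suc u} {zero} ()

  X-injective : Injective _≡_ _≡_ X
  X-injective refl = refl

  Y-injective : Injective _≡_ _≡_ Y
  Y-injective refl = refl

  X≢Y : ∀ {x i} → X x ≢ Y i
  X≢Y ()

  blockGroup : Block N → Fin 8 → Group
  blockGroup B = X ∘ (B ‼_)

  extendedGroup : Fin t → Block N → Fin 9 → Group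
  extendedGroup i B zero    = Y i
  extendedGroup i B (suc k) = blockGroup B k

  module _ {B : Block N} (kB : IsKSubset N 8 B) where

    blockGroup-injective : Injective _≡_ _≡_ (blockGroup B)
    blockGroup-injective = ‼-injective kB ∘ X-injective

    extendedGroup-injective : ∀ {i} → Injective _≡_ _≡_ (extendedGroup i B)
    extendedGroup-injective {x = zero} {zero} _ = refl
    extendedGroup-injective {x = suc k} {suc k′} eq = cong suc (blockGroup-injective eq)

    blockGroup-X⁻ : ∀ {k x} → blockGroup B k ≡ X x → x ∈ B
    blockGroup-X⁻ eq = subst (_∈ B) (X-injective eq) (‼-∈ kB _)

    extendedGroup-X⁻ : ∀ {i k x} → extendedGroup i B k ≡ X x → x ∈ B
    extendedGroup-X⁻ {k = suc k} eq = blockGroup-X⁻ eq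

  extendedGroup-Y⁻ : ∀ {i′ B k i} → extendedGroup i′ B k ≡ Y i → i′ ≡ i
  extendedGroup-Y⁻ {k = zero} refl = refl

  -- The core carries the nested (3t+1,4,1)-BIBD on Y ∪ {∞}; block j B is block B of class j, inflated.
  data Part : Set where
    core  : Part
    block : ℕ → Block N → Part

  Admissible : Part → Set
  Admissible core        = ⊤
  Admissible (block _ B) = IsKSubset N 8 B

  SameGroup : Part → Point → Point → Set
  SameGroup core              P Q = P ≡ Q
  SameGroup (block zero _)    P Q = P ≡ Q
  SameGroup (block (suc _) _) P Q = groupOf P ≡ groupOf Q

  groupOf≢⇒¬SameGroup : ∀ a {P Q} → groupOf P ≢ groupOf Q → ¬ SameGroup a P Q
  groupOf≢⇒¬SameGroup core              groups≢ = groups≢ ∘ cong groupOf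
  groupOf≢⇒¬SameGroup (block zero _)    groups≢ = groups≢ ∘ cong groupOf
  groupOf≢⇒¬SameGroup (block (suc _) _) groups≢ = groups≢

  open Component
  open Gluing Point↔Fin 4

  module Components (coreDesign : Nested (suc (t * 3))) (core-isNestedGDD : IsNestedGDD 4 id coreDesign) where

    gddComponent : ∀ {j} → Block N → Dec (j < t) → Component Point
    gddComponent B (yes j<t) = record
      { size = 9 * 3 ; groups = 9 ; group = quotient 3 ; design = nestedGDD3⁹
      ; embed = layer (extendedGroup (fromℕ< j<t) B) }
    gddComponent B (no _) = record
      { size = 8 * 3 ; groups = 8 ; group = quotient 3 ; design = nestedGDD3⁸
      ; embed = layer (blockGroup B) }

    component : Part → Component Point
    component core = record
      { size = suc (t * 3) ; groups = suc (t * 3) ; group = id ; design = coreDesign ; embed = pointed Y }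
    component (block zero B) = record
      { size = 25 ; groups = 25 ; group = id ; design = nestedBIBD25 ; embed = pointed (blockGroup B) }
    component (block (suc j) B) = gddComponent B (j <? t)

    gddComponent-isEmbeddedGDD : ∀ {j B} → IsKSubset N 8 B → (d : Dec (j < t)) → IsEmbeddedGDD (gddComponent B d)
    gddComponent-isEmbeddedGDD kB (yes _) = nestedGDD3⁹-isNestedGDD , layer-injective _ (extendedGroup-injective kB)
    gddComponent-isEmbeddedGDD kB (no _)  = nestedGDD3⁸-isNestedGDD , layer-injective _ (blockGroup-injective kB)

    component-isEmbeddedGDD : ∀ {a} → Admissible a → IsEmbeddedGDD (component a)
    component-isEmbeddedGDD {core} _ = core-isNestedGDD , pointed-injective Y Y-injective
    component-isEmbeddedGDD {block zero B} kB = nestedBIBD25-isNestedGDD , pointed-injective _ (blockGroup-injective kB)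
    component-isEmbeddedGDD {block (suc j) B} kB = gddComponent-isEmbeddedGDD kB (j <? t)

    gddComponent-covers : ∀ {j B P Q} (d : Dec (j < t)) → let c = gddComponent B d in
      Image c P → Image c Q → groupOf P ≢ groupOf Q → Covers c P Q
    gddComponent-covers {B = B} d@(yes j<t) =
      covers-by (gddComponent B d) groupOf (cong (just ∘ extendedGroup (fromℕ< j<t) B))
    gddComponent-covers {B = B} d@(no _) =
      covers-by (gddComponent B d) groupOf (cong (just ∘ blockGroup B))

    gddComponent-misses : ∀ {j B P Q} → IsKSubset N 8 B → (d : Dec (j < t)) → let c = gddComponent B d in
      (Image c P → Image c Q → groupOf P ≡ groupOf Q) → Misses c P Q
    gddComponent-misses {B = B} kB d@(yes _) =
      misses-by (gddComponent B d) groupOf (extendedGroup-injective kB ∘ just-injective)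
    gddComponent-misses {B = B} kB d@(no _) =
      misses-by (gddComponent B d) groupOf (blockGroup-injective kB ∘ just-injective)

    part-covers : ∀ a {P Q} → Image (component a) P → Image (component a) Q →
      ¬ SameGroup a P Q → Covers (component a) P Q
    part-covers core = covers-by (component core) id (cong (pointed Y))
    part-covers (block zero B) = covers-by (component (block zero B)) id (cong (pointed (blockGroup B)))
    part-covers (block (suc j) B) = gddComponent-covers (j <? t)

    part-misses : ∀ a {P Q} → Admissible a →
      (Image (component a) P → Image (component a) Q → SameGroup a P Q) → Misses (component a) P Q
    part-misses core _ = misses-by (component core) id (pointed-injective Y Y-injective)
    part-misses (block zero B) kB =
      misses-by (component (block zero B)) id (pointed-injective (blockGroup B) (blockGroup-injective kB))
    part-misses (block (suc j) B) kB = gddComponent-misses kB (j <? t)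

    module _ {j : ℕ} {B : Block N} where

      gdd-X-image : ∀ {x} a → IsKSubset N 8 B → x ∈ B → (d : Dec (j < t)) → Image (gddComponent B d) (pt (X x) a)
      gdd-X-image a kB x∈B d with ∈⇒‼ kB x∈B | d
      ... | k , refl | yes j<t = combine {9} (suc k) a , layer-combine (extendedGroup (fromℕ< j<t) B) (suc k) a
      ... | k , refl | no _    = combine {8} k a , layer-combine (blockGroup B) k a

      gdd-X-image⁻ : ∀ {x a} → IsKSubset N 8 B → (d : Dec (j < t)) → Image (gddComponent B d) (pt (X x) a) → x ∈ B
      gdd-X-image⁻ kB (yes j<t) (u , eq) =
        extendedGroup-X⁻ kB (proj₂ (layer-image⁻ (extendedGroup (fromℕ< j<t) B) u eq))
      gdd-X-image⁻ kB (no _) (u , eq) = blockGroup-X⁻ kB (proj₂ (layer-image⁻ (blockGroup B) u eq))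

      gdd-Y-image⁻ : ∀ {i a} (d : Dec (j < t)) → Image (gddComponent B d) (pt (Y i) a) → j ≡ toℕ i
      gdd-Y-image⁻ (yes j<t) (u , eq) =
        trans (sym (toℕ-fromℕ< j<t))
              (cong toℕ (extendedGroup-Y⁻ (proj₂ (layer-image⁻ (extendedGroup (fromℕ< j<t) B) u eq))))
      gdd-Y-image⁻ (no _) (u , eq) with proj₂ (layer-image⁻ (blockGroup B) u eq)
      ... | ()

      gdd-∞-image⁻ : (d : Dec (j < t)) → ¬ Image (gddComponent B d) ∞
      gdd-∞-image⁻ (yes j<t) (u , eq) = layer≢∞ (extendedGroup (fromℕ< j<t) B) u eq
      gdd-∞-image⁻ (no _)    (u , eq) = layer≢∞ (blockGroup B) u eq

    gdd-Y-image : ∀ {B} i a (d : Dec (toℕ i < t)) → Image (gddComponent B d) (pt (Y i) a)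
    gdd-Y-image {B} i a (yes i<t) =
      combine {9} zero a ,
      trans (layer-combine (extendedGroup (fromℕ< i<t) B) zero a) (cong (λ i → pt (Y i) a) (fromℕ<-toℕ i i<t))
    gdd-Y-image i a (no i≮t) = ⊥-elim (i≮t (toℕ<n i))

    X-image : ∀ {j B x} a → IsKSubset N 8 B → x ∈ B → Image (component (block j B)) (pt (X x) a)
    X-image {zero} {B} a kB x∈B with ∈⇒‼ kB x∈B
    ... | k , refl = suc (combine {8} k a) , layer-combine (blockGroup B) k a
    X-image {suc j} a kB x∈B = gdd-X-image a kB x∈B (j <? t)

    X-image⁻ : ∀ {j B x a} → IsKSubset N 8 B → Image (component (block j B)) (pt (X x) a) → x ∈ B
    X-image⁻ {zero} {B} kB (u , eq) = blockGroup-X⁻ kB (proj₂ (pointed-image⁻ (blockGroup B) u eq))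
    X-image⁻ {suc j} kB = gdd-X-image⁻ kB (j <? t)

    Y-image : ∀ {B} i a → Image (component (block (suc (toℕ i)) B)) (pt (Y i) a)
    Y-image i a = gdd-Y-image i a (toℕ i <? t)

    Y-image⁻ : ∀ {j B i a} → Image (component (block j B)) (pt (Y i) a) → j ≡ suc (toℕ i)
    Y-image⁻ {zero} {B} (u , eq) with proj₂ (pointed-image⁻ (blockGroup B) u eq)
    ... | ()
    Y-image⁻ {suc j} = cong suc ∘ gdd-Y-image⁻ (j <? t)

    ∞-image : ∀ {B} → Image (component (block zero B)) ∞
    ∞-image = zero , refl

    ∞-image⁻ : ∀ {j B} → Image (component (block j B)) ∞ → j ≡ zero
    ∞-image⁻ {zero} _ = refl
    ∞-image⁻ {suc j} = ⊥-elim ∘ gdd-∞-image⁻ (j <? t)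

    core-Y-image : ∀ i a → Image (component core) (pt (Y i) a)
    core-Y-image i a = suc (combine {t} i a) , layer-combine Y i a

    core-∞-image : Image (component core) ∞
    core-∞-image = zero , refl

    core-X-image⁻ : ∀ {x a} → ¬ Image (component core) (pt (X x) a)
    core-X-image⁻ (u , eq) with proj₂ (pointed-image⁻ Y u eq)
    ... | ()

    classParts : ℕ → List (List (Block N)) → List Part
    classParts j []       = []
    classParts j (P ∷ Ps) = map (block j) P ++ classParts (suc j) Ps

    ∈-classParts⁻ : ∀ {j Ps a} → a ∈ classParts j Ps → ∃₂ λ i B → a ≡ block i B × j ≤ i × B ∈ concat Ps
    ∈-classParts⁻ {j} {P ∷ Ps} a∈ with ∈-++⁻ (map (block j) P) a∈
    ... | inj₁ a∈P with ∈-map⁻ (block j) a∈P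
    ...   | B , B∈P , refl = j , B , refl , ℕ.≤-refl , ∈-++⁺ˡ B∈P
    ∈-classParts⁻ {j} {P ∷ Ps} a∈ | inj₂ a∈Ps with ∈-classParts⁻ {suc j} {Ps} a∈Ps
    ...   | i , B , refl , j<i , B∈ = i , B , refl , ℕ.<⇒≤ j<i , ∈-++⁺ʳ P B∈

    OnBlock : (ℕ → Block N → Set) → Part → Set
    OnBlock S core        = ⊥
    OnBlock S (block j B) = S j B

    onBlock? : ∀ {S} → (∀ j B → Dec (S j B)) → Decidable (OnBlock S)
    onBlock? S? core        = no λ ()
    onBlock? S? (block j B) = S? j B

    IsCore : Part → Set
    IsCore core        = ⊤
    IsCore (block _ _) = ⊥

    isCore? : Decidable IsCore
    isCore? core        = yes tt
    isCore? (block _ _) = no λ ()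

    open DecMembership (_≟_ {n = N}) using (_∈?_)

    ClassThrough : ℕ → Fin N → ℕ → Block N → Set
    ClassThrough c x j B = j ≡ c × x ∈ B

    classThrough? : ∀ c x j B → Dec (ClassThrough c x j B)
    classThrough? c x j B = (j ℕ.≟ c) ×-dec (x ∈? B)

    count-inBoth : ∀ x x′ j Ps → count (onBlock? λ _ → inBoth? x x′) (classParts j Ps) ≡ pairCount x x′ (concat Ps)
    count-inBoth x x′ j [] = refl
    count-inBoth x x′ j (P ∷ Ps) =
      trans (count-++ (onBlock? λ _ → inBoth? x x′) (map (block j) P) (classParts (suc j) Ps))
        (trans (cong₂ _+_ (count-map (onBlock? λ _ → inBoth? x x′) (block j) P) (count-inBoth x x′ (suc j) Ps))
               (sym (count-++ (inBoth? x x′) P (concat Ps))))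

    count-classThrough : ∀ x {j Ps} → All (IsParallelClass N) Ps → ∀ {c} i → c ≡ j + i → i < length Ps →
      count (onBlock? (classThrough? c x)) (classParts j Ps) ≡ 1
    count-classThrough x {j} {P ∷ Ps} (parallel ∷ _) zero c≡j+0 _ =
      trans (count-++ (onBlock? (classThrough? _ x)) (map (block j) P) (classParts (suc j) Ps))
        (cong₂ _+_ (trans (count-map (onBlock? (classThrough? _ x)) (block j) P)
                          (trans (count-≐ (classThrough? _ x j) (x ∈?_) (proj₂ , (j≡c ,_)) P) (parallel x)))
                   (count-none (onBlock? (classThrough? _ x)) (All.tabulate later)))
      where
      j≡c : j ≡ _
      j≡c = sym (trans c≡j+0 (ℕ.+-identityʳ j))
      later : ∀ {a} → a ∈ classParts (suc j) Ps → ¬ OnBlock (ClassThrough _ x) a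
      later a∈ with ∈-classParts⁻ {suc j} {Ps} a∈
      ... | i , B , refl , j<i , B∈ = λ (i≡c , _) → ℕ.<-irrefl (trans j≡c (sym i≡c)) j<i
    count-classThrough x {j} {P ∷ Ps} (_ ∷ parallels) (suc i) c≡j+1+i (s≤s i<) =
      trans (count-++ (onBlock? (classThrough? _ x)) (map (block j) P) (classParts (suc j) Ps))
        (cong₂ _+_ (trans (count-map (onBlock? (classThrough? _ x)) (block j) P)
                          (count-none (classThrough? _ x j) {P} (All.tabulate λ _ (j≡c , _) → ℕ.m≢1+m+n j (trans j≡c c≡1+j+i))))
                   (count-classThrough x parallels i c≡1+j+i i<))
      where
      c≡1+j+i : _ ≡ suc (j + i)
      c≡1+j+i = trans c≡j+1+i (ℕ.+-suc j i)

    module _ (Ps : List (List (Block N))) (parallel : All (IsParallelClass N) Ps)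
             (bibd : IsBIBD N 8 1 (concat Ps)) (t<r : t < length Ps) where

      parts : List Part
      parts = core ∷ classParts 0 Ps

      parts-admissible : ∀ {a} → a ∈ parts → Admissible a
      parts-admissible (here refl) = tt
      parts-admissible (there a∈) with ∈-classParts⁻ {0} {Ps} a∈
      ... | _ , _ , refl , _ , B∈ = All.lookup (proj₁ bibd) B∈

      blockSelection : ∀ {P Q} {S : ℕ → Block N → Set} (S? : ∀ j B → Dec (S j B)) →
        count (onBlock? S?) (classParts 0 Ps) ≡ 1 → ¬ Image (component core) P →
        (∀ {j B} → IsKSubset N 8 B → S j B →
          Image (component (block j B)) P × Image (component (block j B)) Q × ¬ SameGroup (block j B) P Q) →
        (∀ {j B} → IsKSubset N 8 B → ¬ S j B →
          Image (component (block j B)) P → Image (component (block j B)) Q → SameGroup (block j B) P Q) →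
        Selection component parts P Q
      blockSelection S? one notInCore covered missed = record
        { Selected    = OnBlock _
        ; selected?   = onBlock? S?
        ; exactly-one = one
        ; covers      = λ { {block j B} a∈ s → let (imP , imQ , ¬same) = covered {j} (parts-admissible a∈) s
                                             in part-covers (block j B) imP imQ ¬same }
        ; misses      = λ { {core} _ _ → part-misses core tt λ imP _ → ⊥-elim (notInCore imP)
                          ; {block j B} a∈ ¬s →
                              part-misses (block j B) (parts-admissible a∈) (missed {j} (parts-admissible a∈) ¬s) }
        }

      coreSelection : ∀ {P Q} → P ≢ Q → Image (component core) P → Image (component core) Q →
        (∀ {j B} → Image (component (block j B)) P → Image (component (block j B)) Q → SameGroup (block j B) P Q) →
        Selection component parts P Q
      coreSelection P≢Q imP imQ missed = record
        { Selected    = IsCore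
        ; selected?   = isCore?
        ; exactly-one = cong suc (count-none isCore? (All.tabulate notCore))
        ; covers      = λ { {core} _ _ → part-covers core imP imQ P≢Q }
        ; misses      = λ { {core} _ ¬core → ⊥-elim (¬core tt)
                          ; {block j B} a∈ _ → part-misses (block j B) (parts-admissible a∈) missed }
        }
        where
        notCore : ∀ {a} → a ∈ classParts 0 Ps → ¬ IsCore a
        notCore a∈ with ∈-classParts⁻ {0} {Ps} a∈
        ... | _ , _ , refl , _ = λ ()

      count-class : ∀ x c → c < length Ps → count (onBlock? (classThrough? c x)) (classParts 0 Ps) ≡ 1
      count-class x c c<r = count-classThrough x parallel c refl c<r

      selection : ∀ P Q → P ≢ Q → Selection component parts P Q
      selection (pt (X x) a) (pt (X x′) b) P≢Q with x ≟ x′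
      ... | no x≢x′ =
            blockSelection (λ _ → inBoth? x x′) (trans (count-inBoth x x′ 0 Ps) (proj₂ bibd x x′ x≢x′)) core-X-image⁻
              (λ {j} {B} kB (x∈ , x′∈) → X-image {j} a kB x∈ , X-image {j} b kB x′∈ ,
                                         groupOf≢⇒¬SameGroup (block j B) (x≢x′ ∘ X-injective ∘ just-injective))
              (λ {j} kB ¬both imP imQ → ⊥-elim (¬both (X-image⁻ {j} kB imP , X-image⁻ {j} kB imQ)))
      ... | yes refl = blockSelection (classThrough? 0 x) (count-class x 0 (≤-trans (s≤s z≤n) t<r)) core-X-image⁻
              (λ { kB (refl , x∈) → X-image {0} a kB x∈ , X-image {0} b kB x∈ , P≢Q })
              (λ { {zero} kB ¬s imP _ → ⊥-elim (¬s (refl , X-image⁻ {0} kB imP)) ; {suc _} _ _ _ _ → refl })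
      selection (pt (X x) a) (pt (Y i) b) _ =
        blockSelection (classThrough? (suc (toℕ i)) x) (count-class x (suc (toℕ i)) (≤-trans (s≤s (toℕ<n i)) t<r))
          core-X-image⁻
          (λ { {B = B} kB (refl , x∈) → X-image {suc (toℕ i)} a kB x∈ , Y-image {B} i b ,
                                        groupOf≢⇒¬SameGroup (block (suc (toℕ i)) B) {pt (X x) a} {pt (Y i) b}
                                          (X≢Y ∘ just-injective) })
          (λ {j} kB ¬s imP imQ → ⊥-elim (¬s (Y-image⁻ {j} imQ , X-image⁻ {j} kB imP)))
      selection (pt (X x) a) ∞ _ =
        blockSelection (classThrough? 0 x) (count-class x 0 (≤-trans (s≤s z≤n) t<r)) core-X-image⁻
          (λ { {B = B} kB (refl , x∈) → X-image {0} a kB x∈ , ∞-image {B} , λ () })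
          (λ {j} kB ¬s imP imQ → ⊥-elim (¬s (∞-image⁻ {j} imQ , X-image⁻ {j} kB imP)))
      selection P@(pt (Y _) _) Q@(pt (X _) _) P≢Q = Selection-sym (selection Q P (P≢Q ∘ sym))
      selection ∞ Q@(pt (X _) _) P≢Q = Selection-sym (selection Q ∞ (P≢Q ∘ sym))
      selection (pt (Y i) a) (pt (Y i′) b) P≢Q = coreSelection P≢Q (core-Y-image i a) (core-Y-image i′ b) sameY
        where
        sameY : ∀ {j B} → Image (component (block j B)) (pt (Y i) a) → Image (component (block j B)) (pt (Y i′) b) →
          SameGroup (block j B) (pt (Y i) a) (pt (Y i′) b)
        sameY {j} {B} imP imQ with Y-image⁻ {j} {B} imP | Y-image⁻ {j} {B} imQ
        ... | refl | eq = cong (just ∘ Y) (toℕ-injective (ℕ.suc-injective eq))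
      selection (pt (Y i) a) ∞ P≢Q = coreSelection P≢Q (core-Y-image i a) core-∞-image
        λ {j} imP imQ → ⊥-elim (ℕ.0≢1+n (trans (sym (∞-image⁻ {j} imQ)) (Y-image⁻ {j} imP)))
      selection ∞ (pt (Y i) b) P≢Q = coreSelection P≢Q core-∞-image (core-Y-image i b)
        λ {j} imP imQ → ⊥-elim (ℕ.0≢1+n (trans (sym (∞-image⁻ {j} imP)) (Y-image⁻ {j} imQ)))
      selection ∞ ∞ P≢Q = ⊥-elim (P≢Q refl)

      construction : NestedBIBD V 4 1
      construction =
        nestedGDD⇒nestedBIBD (glued-isNestedGDD component parts (component-isEmbeddedGDD ∘ parts-admissible) selection)

  nestedBIBD : 7 * suc t ≤ n → ResolvableBIBD N 8 1 → NestedBIBD (suc (t * 3)) 4 1 → NestedBIBD V 4 1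
  nestedBIBD 7[t+1]≤n (Ps , parallel , bibd) nested with nestedBIBD⇒nestedGDD nested
  ... | coreDesign , core-isNestedGDD = Components.construction coreDesign core-isNestedGDD Ps parallel bibd
        (ℕ.*-cancelˡ-≤ 7 (≤-trans 7[t+1]≤n (resolution-length Ps parallel bibd)))

private
  construction-size : ∀ m t → suc (56 * m + 7) * 3 + suc (t * 3) ≡ 168 * m + 3 * t + 25
  construction-size = solve-∀

  resolution-size : ∀ m → 56 * m + 8 ≡ suc (56 * m + 7)
  resolution-size = solve-∀

  core-size : ∀ t → 3 * t + 1 ≡ suc (t * 3)
  core-size = solve-∀

  replication : ∀ m → 7 * suc (8 * m) ≡ 56 * m + 7
  replication = solve-∀

lemma4p16 : (m t : ℕ) → ResolvableBIBD (56 * m + 8) 8 1 → t ≤ 8 * m →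
    NestedBIBD (3 * t + 1) 4 1 → NestedBIBD (168 * m + 3 * t + 25) 4 1
lemma4p16 m t resolvable t≤8m nested =
  subst (λ v → NestedBIBD v 4 1) (construction-size m t)
    (Construction.nestedBIBD (56 * m + 7) t
      (≤-trans (*-monoʳ-≤ 7 (s≤s t≤8m)) (≤-reflexive (replication m)))
      (subst (λ v → ResolvableBIBD v 8 1) (resolution-size m) resolvable)
      (subst (λ v → NestedBIBD v 4 1) (core-size t) nested))
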